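{- Let $k\ge1$ and $m=2^k-1$. Then $C(m)$ is the set of $p\ge0$ with $p\equiv 2^k-2\pmod{2^k}$ (i.e. $C(m)\cap[0,2^k)=\{2^k-2\}$, periodic with period $2^k$), and for all $n\ge0$, \[ c_{2^k-1}(n)=a_{2^k-1}(\lfloor n/D_k\rfloor),\qquad D_k=2^{2^k-2}. \]
   Context: For $n\ge0$ write $b_p(n)=\lfloor n/2^p\rfloor\bmod 2$; $\oplus$ is XOR and $\&$ is bitwise AND. $a_m(n)=\bigoplus_{p\ge0,\ p\,\&\,m=0}b_p(n)$; $K(m)=\max(1,\lceil\log_2(m+1)\rceil)$. The correction set $C(m)\subseteq\mathbb N$ is defined recursively: $C(0)=\emptyset$; for odd $m\ge1$, with $K=K(m)$ and $r=m-2^{K-1}$, $C(m)$ is periodic with period $2^K$ and $C(m)\cap[0,2^K)=\{2^K-2\}\cup(C(r)\cap[0,2^{K-1}-2))$; for even $m\ge2$, $C(m)=C(m-1)$. Set $c_m(n)=\bigoplus_{p\in C(m)}b_p(n)$. -}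

module Defs where

open import Data.Bool using (Bool; true; false; not; _∧_; _∨_; _xor_; if_then_else_)
open import Data.Nat using (ℕ; zero; suc; _+_; _*_; _∸_; _^_; _⊔_; _≡ᵇ_; _<ᵇ_; _/_; _%_)
open import Data.Nat.Properties using (m^n≢0)
open import Data.Nat.Logarithm using (⌈log₂_⌉)

_div2^_ : ℕ → ℕ → ℕ
n div2^ p = _/_ n (2 ^ p) {{m^n≢0 2 p}}

_mod2^_ : ℕ → ℕ → ℕ
n mod2^ p = _%_ n (2 ^ p) {{m^n≢0 2 p}}

b : ℕ → ℕ → Bool
b p n = ((n div2^ p) % 2) ≡ᵇ 1

bigXor : ℕ → (ℕ → Bool) → Bool
bigXor zero    f = false
bigXor (suc N) f = bigXor N f xor f N

bigAnd : ℕ → (ℕ → Bool) → Bool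
bigAnd zero    f = true
bigAnd (suc N) f = bigAnd N f ∧ f N

-- p & m = 0 (bitwise AND is zero); bits of p at positions ≥ p+1 vanish
andZero : ℕ → ℕ → Bool
andZero p m = bigAnd (suc p) (λ i → not (b i p ∧ b i m))

K : ℕ → ℕ
K m = 1 ⊔ ⌈log₂ (suc m) ⌉

isOdd : ℕ → Bool
isOdd m = (m % 2) ≡ᵇ 1

-- membership p ∈ C(m), computed with fuel (fuel m+1 suffices, as each
-- recursive step strictly decreases m: r < m for odd m, m-1 < m for even m)
inCFuel : ℕ → ℕ → ℕ → Bool
inCFuel zero       m       p = false
inCFuel (suc fuel) zero    p = false
inCFuel (suc fuel) (suc m') p =
  if isOdd (suc m')
  then (let m  = suc m'
            k  = K m
            r  = m ∸ 2 ^ (k ∸ 1)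
            q  = p mod2^ k
        in (q ≡ᵇ (2 ^ k ∸ 2)) ∨ ((q <ᵇ (2 ^ (k ∸ 1) ∸ 2)) ∧ inCFuel fuel r q))
  else inCFuel fuel m' p

inC : ℕ → ℕ → Bool
inC m p = inCFuel (suc m) m p

-- a_m(n) = XOR of b_p(n) over p with p & m = 0; b_p(n) = 0 for p ≥ n+1,
-- so only p < n+1 contribute
a : ℕ → ℕ → Bool
a m n = bigXor (suc n) (λ p → andZero p m ∧ b p n)

c : ℕ → ℕ → Bool
c m n = bigXor (suc n) (λ p → inC m p ∧ b p n)

-- For m = 2^k − 1 the recursion defining C(m) never contributes: its second
-- branch asks whether a residue below 2^(k−1) − 2 lies in C(2^(k−1) − 1), which
-- by induction only contains residues ≡ 2^(k−1) − 2. So C(m) is the class of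
-- 2^k − 2 mod 2^k. Since the bits of m are exactly those below k, p & m = 0
-- means 2^k ∣ p, and shifting n right by 2^k − 2 moves those positions onto
-- the class of 2^k − 2. Both sides are thus the XOR of the bits of n at the
-- positions ≡ 2^k − 2 (mod 2^k).
module Submission where

open import Defs
open import Data.Bool using (Bool; true; false; not; _∧_; _∨_; _xor_)
open import Data.Bool.Properties
  using (xor-assoc; xor-identityʳ; ∧-zeroʳ; ∧-identityʳ; ∧-assoc; ¬-not; T-≡; T-∨; T-∧)
open import Data.Empty using (⊥-elim)
open import Data.Nat
open import Data.Nat.DivMod
open import Data.Nat.Divisibility using (m∣m*n)
open import Data.Nat.Logarithm using (⌈log₂2^n⌉≡n)
open import Data.Nat.Properties
open import Data.Product using (_×_; _,_)
open import Data.Sum using (inj₁; inj₂)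
open import Function.Bundles using (_⇔_; mk⇔; Equivalence)
open import Relation.Binary.PropositionalEquality
open ≡-Reasoning

open Equivalence using (to; from)

bigXor-cong : ∀ N (f g : ℕ → Bool) → (∀ i → i < N → f i ≡ g i) → bigXor N f ≡ bigXor N g
bigXor-cong zero    f g f≗g = refl
bigXor-cong (suc N) f g f≗g =
  cong₂ _xor_ (bigXor-cong N f g (λ i i<N → f≗g i (m<n⇒m<1+n i<N))) (f≗g N ≤-refl)

bigXor-tail : ∀ M N (f : ℕ → Bool) → M ≤ N → (∀ i → M ≤ i → i < N → f i ≡ false) →
              bigXor N f ≡ bigXor M f
bigXor-tail M zero    f z≤n   _   = refl
bigXor-tail M (suc N) f M≤1+N off with m≤n⇒m<n∨m≡n M≤1+N
... | inj₂ refl = refl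
... | inj₁ M<1+N = begin
  bigXor N f xor f N   ≡⟨ cong₂ _xor_ (bigXor-tail M N f M≤N off′) (off N M≤N ≤-refl) ⟩
  bigXor M f xor false ≡⟨ xor-identityʳ _ ⟩
  bigXor M f           ∎
  where
  M≤N = ≤-pred M<1+N
  off′ : ∀ i → M ≤ i → i < N → f i ≡ false
  off′ i M≤i i<N = off i M≤i (m<n⇒m<1+n i<N)

bigXor-+ : ∀ M N (f : ℕ → Bool) → bigXor (M + N) f ≡ bigXor M f xor bigXor N (λ i → f (M + i))
bigXor-+ M zero f = begin
  bigXor (M + 0) f     ≡⟨ cong (λ n → bigXor n f) (+-identityʳ M) ⟩
  bigXor M f           ≡⟨ xor-identityʳ _ ⟨
  bigXor M f xor false ∎
bigXor-+ M (suc N) f = begin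
  bigXor (M + suc N) f                    ≡⟨ cong (λ n → bigXor n f) (+-suc M N) ⟩
  bigXor (M + N) f xor f (M + N)          ≡⟨ cong (_xor f (M + N)) (bigXor-+ M N f) ⟩
  (bigXor M f xor bigXor N g) xor g N     ≡⟨ xor-assoc (bigXor M f) (bigXor N g) (g N) ⟩
  bigXor M f xor (bigXor N g xor g N)     ∎
  where
  g : ℕ → Bool
  g i = f (M + i)

bigXor-blocks : ∀ L T (f : ℕ → Bool) →
                bigXor (T * L) f ≡ bigXor T (λ t → bigXor L (λ i → f (t * L + i)))
bigXor-blocks L zero    f = refl
bigXor-blocks L (suc T) f = begin
  bigXor (L + T * L) f                                  ≡⟨ cong (λ n → bigXor n f) (+-comm L (T * L)) ⟩
  bigXor (T * L + L) f                                  ≡⟨ bigXor-+ (T * L) L f ⟩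
  bigXor (T * L) f xor bigXor L (λ i → f (T * L + i))   ≡⟨ cong (_xor bigXor L (λ i → f (T * L + i))) (bigXor-blocks L T f) ⟩
  bigXor (suc T) (λ t → bigXor L (λ i → f (t * L + i))) ∎

bigXor-single : ∀ L j (f : ℕ → Bool) → j < L → (∀ i → i < L → i ≢ j → f i ≡ false) →
                bigXor L f ≡ f j
bigXor-single (suc L) j f j<1+L off with m≤n⇒m<n∨m≡n (≤-pred j<1+L)
... | inj₁ j<L = begin
  bigXor L f xor f L ≡⟨ cong₂ _xor_ (bigXor-single L j f j<L off′) (off L ≤-refl (≢-sym (<⇒≢ j<L))) ⟩
  f j xor false      ≡⟨ xor-identityʳ (f j) ⟩
  f j                ∎
  where
  off′ : ∀ i → i < L → i ≢ j → f i ≡ false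
  off′ i i<L = off i (m<n⇒m<1+n i<L)
... | inj₂ refl =
  cong (_xor f L) (bigXor-tail 0 L f z≤n (λ i _ i<L → off i (m<n⇒m<1+n i<L) (<⇒≢ i<L)))

bigXor-sample : ∀ L T N j (f : ℕ → Bool) → j < L → N ≤ T * L →
                (∀ p → N ≤ p → f p ≡ false) →
                (∀ t i → i < L → i ≢ j → f (t * L + i) ≡ false) →
                bigXor N f ≡ bigXor T (λ t → f (t * L + j))
bigXor-sample L T N j f j<L N≤TL beyond off = begin
  bigXor N f                                      ≡⟨ bigXor-tail N (T * L) f N≤TL (λ p N≤p _ → beyond p N≤p) ⟨
  bigXor (T * L) f                                ≡⟨ bigXor-blocks L T f ⟩
  bigXor T (λ t → bigXor L (λ i → f (t * L + i))) ≡⟨ bigXor-cong T _ _ (λ t _ → bigXor-single L j _ j<L (off t)) ⟩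
  bigXor T (λ t → f (t * L + j))                  ∎

bigAnd-cong : ∀ N (f g : ℕ → Bool) → (∀ i → i < N → f i ≡ g i) → bigAnd N f ≡ bigAnd N g
bigAnd-cong zero    f g f≗g = refl
bigAnd-cong (suc N) f g f≗g =
  cong₂ _∧_ (bigAnd-cong N f g (λ i i<N → f≗g i (m<n⇒m<1+n i<N))) (f≗g N ≤-refl)

bigAnd-tail : ∀ M N (f : ℕ → Bool) → M ≤ N → (∀ i → M ≤ i → f i ≡ true) →
              bigAnd N f ≡ bigAnd M f
bigAnd-tail M zero    f z≤n   _  = refl
bigAnd-tail M (suc N) f M≤1+N on with m≤n⇒m<n∨m≡n M≤1+N
... | inj₂ refl = refl
... | inj₁ M<1+N = begin
  bigAnd N f ∧ f N  ≡⟨ cong₂ _∧_ (bigAnd-tail M N f (≤-pred M<1+N) on) (on N (≤-pred M<1+N)) ⟩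
  bigAnd M f ∧ true ≡⟨ ∧-identityʳ _ ⟩
  bigAnd M f        ∎

bigAnd-suc : ∀ N (f : ℕ → Bool) → bigAnd (suc N) f ≡ f 0 ∧ bigAnd N (λ j → f (suc j))
bigAnd-suc zero    f = sym (∧-identityʳ (f 0))
bigAnd-suc (suc N) f = begin
  bigAnd (suc N) f ∧ f (suc N)                       ≡⟨ cong (_∧ f (suc N)) (bigAnd-suc N f) ⟩
  (f 0 ∧ bigAnd N (λ j → f (suc j))) ∧ f (suc N)     ≡⟨ ∧-assoc (f 0) _ _ ⟩
  f 0 ∧ bigAnd (suc N) (λ j → f (suc j))             ∎

n<2^n : ∀ n → n < 2 ^ n
n<2^n zero    = s≤s z≤n
n<2^n (suc n) = +-mono-≤ (m^n>0 2 n) (≤-trans (n<2^n n) (m≤m+n (2 ^ n) 0))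

b-beyond : ∀ p n → n < 2 ^ p → b p n ≡ false
b-beyond p n n<2^p rewrite m<n⇒m/n≡0 {{m^n≢0 2 p}} n<2^p = refl

b-above : ∀ p n → n ≤ p → b p n ≡ false
b-above p n n≤p = b-beyond p n (<-≤-trans (n<2^n n) (^-monoʳ-≤ 2 n≤p))

b-div2^ : ∀ D p n → b p (n div2^ D) ≡ b (D + p) n
b-div2^ D p n = cong (λ x → x % 2 ≡ᵇ 1) (begin
  n / 2 ^ D / 2 ^ p     ≡⟨ m/n/o≡m/[n*o] n (2 ^ D) (2 ^ p) ⟩
  n / (2 ^ D * 2 ^ p)   ≡⟨ /-congʳ (sym (^-distribˡ-+-* 2 D p)) ⟩
  n / 2 ^ (D + p)       ∎)
  where
  instance
    2^D≢0 : NonZero (2 ^ D)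
    2^D≢0 = m^n≢0 2 D
    2^p≢0 : NonZero (2 ^ p)
    2^p≢0 = m^n≢0 2 p
    2^[D+p]≢0 : NonZero (2 ^ (D + p))
    2^[D+p]≢0 = m^n≢0 2 (D + p)
    2^D*2^p≢0 : NonZero (2 ^ D * 2 ^ p)
    2^D*2^p≢0 = m*n≢0 (2 ^ D) (2 ^ p)

b-zero : ∀ n → b 0 n ≡ (n % 2 ≡ᵇ 1)
b-zero n = cong (λ x → x % 2 ≡ᵇ 1) (n/1≡n n)

b-suc : ∀ j n → b (suc j) n ≡ b j (n / 2)
b-suc j n = sym (b-div2^ 1 j n)

m∸1+n<m : ∀ m n → 1 ≤ m → m ∸ suc n < m
m∸1+n<m (suc m) n _ = s≤s (m∸n≤m m n)

mod2^-block : ∀ k t i → i < 2 ^ k → (t * 2 ^ k + i) mod2^ k ≡ i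
mod2^-block k t i i<2^k = begin
  (t * 2 ^ k + i) % 2 ^ k   ≡⟨ cong (_% 2 ^ k) (+-comm (t * 2 ^ k) i) ⟩
  (i + t * 2 ^ k) % 2 ^ k   ≡⟨ [m+kn]%n≡m%n i t (2 ^ k) ⟩
  i % 2 ^ k                 ≡⟨ m<n⇒m%n≡m i<2^k ⟩
  i                         ∎
  where
  instance
    2^k≢0 : NonZero (2 ^ k)
    2^k≢0 = m^n≢0 2 k

double-pred : ∀ y → 1 ≤ y → 2 * y ∸ 1 ≡ 1 + (y ∸ 1) * 2
double-pred (suc z) _ rewrite +-identityʳ z | +-suc z z | *-comm z 2 | +-identityʳ z = refl

mersenne-suc : ∀ k → 2 ^ suc k ∸ 1 ≡ 1 + (2 ^ k ∸ 1) * 2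
mersenne-suc k = double-pred (2 ^ k) (m^n>0 2 k)

mersenne-suc∸2^ : ∀ k → 2 ^ suc k ∸ 1 ∸ 2 ^ k ≡ 2 ^ k ∸ 1
mersenne-suc∸2^ k with 2 ^ k | m^n>0 2 k
... | suc z | _ rewrite +-identityʳ z | +-suc z z = m+n∸n≡m z z

odd-%2 : ∀ z → (1 + z * 2) % 2 ≡ 1
odd-%2 z = [m+kn]%n≡m%n 1 z 2

odd-/2 : ∀ z → (1 + z * 2) / 2 ≡ z
odd-/2 z = begin
  (1 + z * 2) / 2        ≡⟨ +-distrib-/ 1 (z * 2) (subst (λ x → 1 + x < 2) (sym (m*n%n≡0 z 2)) ≤-refl) ⟩
  1 / 2 + z * 2 / 2      ≡⟨ cong (1 / 2 +_) (m*n/n≡m z 2) ⟩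
  z                      ∎

mersenne-odd : ∀ k → isOdd (2 ^ suc k ∸ 1) ≡ true
mersenne-odd k rewrite mersenne-suc k | odd-%2 (2 ^ k ∸ 1) = refl

b-mersenne : ∀ k j → j < k → b j (2 ^ k ∸ 1) ≡ true
b-mersenne (suc k) zero    _ rewrite b-zero (2 ^ suc k ∸ 1) | mersenne-suc k | odd-%2 (2 ^ k ∸ 1) = refl
b-mersenne (suc k) (suc j) (s≤s j<k) rewrite b-suc j (2 ^ suc k ∸ 1) | mersenne-suc k | odd-/2 (2 ^ k ∸ 1) =
  b-mersenne k j j<k

b-mersenne-above : ∀ k j → k ≤ j → b j (2 ^ k ∸ 1) ≡ false
b-mersenne-above k j k≤j = b-beyond j (2 ^ k ∸ 1) (<-≤-trans (m∸1+n<m (2 ^ k) 0 (m^n>0 2 k)) (^-monoʳ-≤ 2 k≤j))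

K-mersenne : ∀ k → K (2 ^ suc k ∸ 1) ≡ suc k
K-mersenne k rewrite m+[n∸m]≡n {1} {2 ^ suc k} (m^n>0 2 (suc k)) = cong (1 ⊔_) (⌈log₂2^n⌉≡n (suc k))

-- p & (2^k − 1) = 0 exactly when 2^k divides p

≡ᵇ0-halves : ∀ r → (r ≡ᵇ 0) ≡ not (r % 2 ≡ᵇ 1) ∧ (r / 2 ≡ᵇ 0)
≡ᵇ0-halves zero          = refl
≡ᵇ0-halves (suc zero)    = refl
≡ᵇ0-halves (suc (suc r)) rewrite m/n≡1+[m∸n]/n {suc (suc r)} {2} (s≤s (s≤s z≤n)) = sym (∧-zeroʳ _)

mod2^-suc-%2 : ∀ k p → (p mod2^ suc k) % 2 ≡ p % 2
mod2^-suc-%2 k p = m∣n⇒o%n%m≡o%m 2 (2 * 2 ^ k) p {{_}} {{m^n≢0 2 (suc k)}} (m∣m*n (2 ^ k))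

mod2^-suc-/2 : ∀ k p → (p mod2^ suc k) / 2 ≡ (p / 2) mod2^ k
mod2^-suc-/2 k p = begin
  p % (2 * 2 ^ k) / 2   ≡⟨ cong (_/ 2) (%-congʳ (*-comm 2 (2 ^ k))) ⟩
  p % (2 ^ k * 2) / 2   ≡⟨ m%[n*o]/o≡m/o%n p (2 ^ k) 2 ⟩
  p / 2 % 2 ^ k         ∎
  where
  instance
    2^k≢0 : NonZero (2 ^ k)
    2^k≢0 = m^n≢0 2 k
    2^[1+k]≢0 : NonZero (2 * 2 ^ k)
    2^[1+k]≢0 = m^n≢0 2 (suc k)
    2^k*2≢0 : NonZero (2 ^ k * 2)
    2^k*2≢0 = m*n≢0 (2 ^ k) 2

lowBits-zero : ∀ k p → bigAnd k (λ j → not (b j p)) ≡ (p mod2^ k ≡ᵇ 0)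
lowBits-zero zero    p = cong (_≡ᵇ 0) (sym (n%1≡0 p))
lowBits-zero (suc k) p = begin
  bigAnd (suc k) (λ j → not (b j p))
    ≡⟨ bigAnd-suc k _ ⟩
  not (b 0 p) ∧ bigAnd k (λ j → not (b (suc j) p))
    ≡⟨ cong₂ (λ x y → not x ∧ y) (b-zero p) (bigAnd-cong k _ _ (λ j _ → cong not (b-suc j p))) ⟩
  not (p % 2 ≡ᵇ 1) ∧ bigAnd k (λ j → not (b j (p / 2)))
    ≡⟨ cong (not (p % 2 ≡ᵇ 1) ∧_) (lowBits-zero k (p / 2)) ⟩
  not (p % 2 ≡ᵇ 1) ∧ ((p / 2) mod2^ k ≡ᵇ 0)
    ≡⟨ cong₂ (λ x y → not (x ≡ᵇ 1) ∧ (y ≡ᵇ 0)) (mod2^-suc-%2 k p) (mod2^-suc-/2 k p) ⟨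
  not (p mod2^ suc k % 2 ≡ᵇ 1) ∧ (p mod2^ suc k / 2 ≡ᵇ 0)
    ≡⟨ ≡ᵇ0-halves (p mod2^ suc k) ⟨
  (p mod2^ suc k ≡ᵇ 0)
    ∎

andZero-mersenne : ∀ k p → andZero p (2 ^ k ∸ 1) ≡ (p mod2^ k ≡ᵇ 0)
andZero-mersenne k p = begin
  bigAnd (suc p) disjoint                 ≡⟨ bigAnd-tail (suc p) (suc p + k) disjoint (m≤m+n (suc p) k) above-p ⟨
  bigAnd (suc p + k) disjoint             ≡⟨ bigAnd-tail k (suc p + k) disjoint (m≤n+m k (suc p)) above-k ⟩
  bigAnd k disjoint                       ≡⟨ bigAnd-cong k _ _ below-k ⟩
  bigAnd k (λ j → not (b j p))            ≡⟨ lowBits-zero k p ⟩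
  (p mod2^ k ≡ᵇ 0)                        ∎
  where
  disjoint : ℕ → Bool
  disjoint j = not (b j p ∧ b j (2 ^ k ∸ 1))
  above-p : ∀ j → suc p ≤ j → disjoint j ≡ true
  above-p j p<j rewrite b-above j p (<⇒≤ p<j) = refl
  above-k : ∀ j → k ≤ j → disjoint j ≡ true
  above-k j k≤j rewrite b-mersenne-above k j k≤j | ∧-zeroʳ (b j p) = refl
  below-k : ∀ j → j < k → disjoint j ≡ not (b j p)
  below-k j j<k rewrite b-mersenne k j j<k | ∧-identityʳ (b j p) = refl

-- The correction set of 2^k − 1

inCFuel-odd : ∀ f m q {k r} → isOdd m ≡ true → K m ≡ k → m ∸ 2 ^ (k ∸ 1) ≡ r →
              inCFuel (suc f) m q ≡ (q mod2^ k ≡ᵇ 2 ^ k ∸ 2)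
                                    ∨ ((q mod2^ k <ᵇ 2 ^ (k ∸ 1) ∸ 2) ∧ inCFuel f r (q mod2^ k))
inCFuel-odd f (suc m) q odd refl refl rewrite odd = refl

inCFuel-mersenne : ∀ f k q →
  inCFuel (suc f) (2 ^ suc k ∸ 1) q ≡ (q mod2^ suc k ≡ᵇ 2 ^ suc k ∸ 2)
    ∨ ((q mod2^ suc k <ᵇ 2 ^ k ∸ 2) ∧ inCFuel f (2 ^ k ∸ 1) (q mod2^ suc k))
inCFuel-mersenne f k q = inCFuel-odd f _ q (mersenne-odd k) (K-mersenne k) (mersenne-suc∸2^ k)

inCFuel-mersenne-sound : ∀ f k q → inCFuel f (2 ^ k ∸ 1) q ≡ true → q mod2^ k ≡ 2 ^ k ∸ 2
inCFuel-mersenne-sound zero    k       q ()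
inCFuel-mersenne-sound (suc f) zero    q ()
inCFuel-mersenne-sound (suc f) (suc k) q q∈C
  with to T-∨ (from T-≡ (trans (sym (inCFuel-mersenne f k q)) q∈C))
... | inj₁ hit = ≡ᵇ⇒≡ _ _ hit
... | inj₂ recursive with to T-∧ recursive
...   | r<2^k∸2 , r∈C = ⊥-elim (<⇒≢ r<D (begin
  r             ≡⟨ m<n⇒m%n≡m {{m^n≢0 2 k}} r<2^k ⟨
  r mod2^ k     ≡⟨ inCFuel-mersenne-sound f k r (to T-≡ r∈C) ⟩
  2 ^ k ∸ 2     ∎))
  where
  r = q mod2^ suc k
  r<D : r < 2 ^ k ∸ 2
  r<D = <ᵇ⇒< _ _ r<2^k∸2
  r<2^k : r < 2 ^ k
  r<2^k = <-≤-trans r<D (m∸n≤m (2 ^ k) 2)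

inC-mersenne : ∀ k p → inC (2 ^ suc k ∸ 1) p ≡ true ⇔ p mod2^ suc k ≡ 2 ^ suc k ∸ 2
inC-mersenne k p = mk⇔ (inCFuel-mersenne-sound (suc m) (suc k) p) λ p≡ →
  trans (inCFuel-mersenne m k p) (cong (_∨ recursive) (to T-≡ (≡⇒≡ᵇ _ _ p≡)))
  where
  m = 2 ^ suc k ∸ 1
  recursive = (p mod2^ suc k <ᵇ 2 ^ k ∸ 2) ∧ inCFuel m (2 ^ k ∸ 1) (p mod2^ suc k)

-- Both sides as XORs over one residue class of bit positions

-- Positions t·L + D with t > n are ≥ n + 1, where n has no 1-bits.
residueBitsXor : ℕ → ℕ → ℕ → Bool
residueBitsXor L D n = bigXor (suc n) (λ t → b (t * L + D) n)

c-mersenne : ∀ k n → c (2 ^ suc k ∸ 1) n ≡ residueBitsXor (2 ^ suc k) (2 ^ suc k ∸ 2) n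
c-mersenne k n = begin
  bigXor (suc n) f
    ≡⟨ bigXor-sample L (suc n) (suc n) D f D<L (m≤m*n (suc n) L {{m^n≢0 2 (suc k)}}) beyond off ⟩
  bigXor (suc n) (λ t → f (t * L + D))
    ≡⟨ bigXor-cong (suc n) _ _ (λ t _ → cong (_∧ b (t * L + D) n) (from (inC-mersenne k _) (mod2^-block (suc k) t D D<L))) ⟩
  residueBitsXor L D n
    ∎
  where
  L = 2 ^ suc k
  D = 2 ^ suc k ∸ 2
  f : ℕ → Bool
  f p = inC (L ∸ 1) p ∧ b p n
  D<L : D < L
  D<L = m∸1+n<m L 1 (m^n>0 2 (suc k))
  beyond : ∀ p → suc n ≤ p → f p ≡ false
  beyond p n<p rewrite b-above p n (<⇒≤ n<p) = ∧-zeroʳ _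
  off : ∀ t i → i < L → i ≢ D → f (t * L + i) ≡ false
  off t i i<L i≢D = cong (_∧ b (t * L + i) n) (¬-not λ i∈C →
    i≢D (trans (sym (mod2^-block (suc k) t i i<L)) (to (inC-mersenne k _) i∈C)))

a-mersenne-shift : ∀ k n → a (2 ^ k ∸ 1) (n div2^ (2 ^ k ∸ 2)) ≡ residueBitsXor (2 ^ k) (2 ^ k ∸ 2) n
a-mersenne-shift k n = begin
  bigXor (suc n′) f
    ≡⟨ bigXor-sample L (suc n) (suc n′) 0 f (m^n>0 2 k) n′<[1+n]L beyond off ⟩
  bigXor (suc n) (λ t → f (t * L + 0))
    ≡⟨ bigXor-cong (suc n) _ _ (λ t _ → sample t) ⟩
  residueBitsXor L D n
    ∎
  where
  L = 2 ^ k
  D = 2 ^ k ∸ 2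
  n′ = n div2^ D
  f : ℕ → Bool
  f p = andZero p (L ∸ 1) ∧ b p n′
  n′<[1+n]L : suc n′ ≤ suc n * L
  n′<[1+n]L = ≤-trans (s≤s (m/n≤m n (2 ^ D) {{m^n≢0 2 D}})) (m≤m*n (suc n) L {{m^n≢0 2 k}})
  beyond : ∀ p → suc n′ ≤ p → f p ≡ false
  beyond p n′<p rewrite b-above p n′ (<⇒≤ n′<p) = ∧-zeroʳ _
  andZero-block : ∀ t i → i < L → andZero (t * L + i) (L ∸ 1) ≡ (i ≡ᵇ 0)
  andZero-block t i i<L = trans (andZero-mersenne k _) (cong (_≡ᵇ 0) (mod2^-block k t i i<L))
  off : ∀ t i → i < L → i ≢ 0 → f (t * L + i) ≡ false
  off t zero    _   0≢0 = ⊥-elim (0≢0 refl)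
  off t (suc i) i<L _   = cong (_∧ b (t * L + suc i) n′) (andZero-block t (suc i) i<L)
  sample : ∀ t → f (t * L + 0) ≡ b (t * L + D) n
  sample t = begin
    andZero (t * L + 0) (L ∸ 1) ∧ b (t * L + 0) n′ ≡⟨ cong (_∧ b (t * L + 0) n′) (andZero-block t 0 (m^n>0 2 k)) ⟩
    b (t * L + 0) n′                              ≡⟨ b-div2^ D _ n ⟩
    b (D + (t * L + 0)) n                         ≡⟨ cong (λ p → b (D + p) n) (+-identityʳ (t * L)) ⟩
    b (D + t * L) n                               ≡⟨ cong (λ p → b p n) (+-comm D (t * L)) ⟩
    b (t * L + D) n                               ∎

corollary29 : (k : ℕ) → k ≥ 1 →
    ((p : ℕ) → (inC (2 ^ k ∸ 1) p ≡ true) ⇔ (p mod2^ k ≡ 2 ^ k ∸ 2))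
    × ((n : ℕ) → c (2 ^ k ∸ 1) n ≡ a (2 ^ k ∸ 1) (n div2^ (2 ^ k ∸ 2)))
corollary29 (suc k) _ = inC-mersenne k , λ n → trans (c-mersenne k n) (sym (a-mersenne-shift (suc k) n))
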